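{- Let $\lambda\ge1$ be a fixed time window size and let $L^n$ be the path with node set $V=\{0,\dots,n-1\}$ and edges $(i,i+1)$, $0\le i\le n-2$, with threshold function $t$ satisfying $1\le t(v)\le\deg(v)$ (so $t(0)=t(n-1)=1$ and $t(i)\in\{1,2\}$ otherwise), and suppose at least two nodes have threshold $2$. Let $\ell=\min\{i\in V: t(i)=2\}$ and $s=\max\{i\in V: t(i)=2\}$. Then there exists a minimum-size TWC target set $S$ for $L^n$ such that (a) $S\cap\{0,\dots,\ell-1\}=\emptyset=S\cap\{s+1,\dots,n-1\}$, and (b) $\ell\in S$ and $s\in S$.
   Context: For a graph $G=(V,E)$ with thresholds $t:V\to\{1,2,\dots\}$, a time window size $\lambda\in\{1,2,\dots\}$ and $S\subseteq V$, define $\mathrm{Inf}[S,0]=S$, $\mathrm{Act}[S,0]=\emptyset$, and for $r\ge1$: $\mathrm{Act}[S,r]=\mathrm{Inf}[S,r-1]$ if $r\le\lambda$, $\mathrm{Act}[S,r]=\mathrm{Inf}[S,r-1]\setminus\mathrm{Inf}[S,r-1-\lambda]$ if $r>\lambda$, and $\mathrm{Inf}[S,r]=\mathrm{Inf}[S,r-1]\cup\{v: |N(v)\cap \mathrm{Act}[S,r]|\ge t(v)\}$, where $N(v)$ is the neighborhood of $v$. $S$ is a TWC target set if $\mathrm{Inf}[S,r]=V$ for some $r\ge0$. -}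

module Defs where

open import Data.Nat using (ℕ; zero; suc; _+_; _∸_; _≤_; _≤ᵇ_; _≡ᵇ_)
open import Data.Bool using (Bool; true; false; _∧_; _∨_; not; if_then_else_)
open import Data.Fin using (Fin; toℕ)
open import Data.Fin.Subset using (Subset; ∣_∣; _∈_)
open import Data.Vec using (lookup)
open import Data.List using (List; map; allFin)
open import Data.Nat.ListAction using (sum)
open import Data.Product using (∃; _×_)
open import Relation.Binary.PropositionalEquality using (_≡_)

-- A (simple, undirected) graph on node set Fin n, given by a Boolean adjacency
-- relation; N(v) = { u | adj v u ≡ true }.
Adj : ℕ → Set
Adj n = Fin n → Fin n → Bool

countNbr : ∀ {n} → Adj n → (Fin n → Bool) → Fin n → ℕ
countNbr {n} adj P v = sum (map (λ u → if adj v u ∧ P u then 1 else 0) (allFin n))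

deg : ∀ {n} → Adj n → Fin n → ℕ
deg adj v = countNbr adj (λ _ → true) v

-- Given f j = (characteristic function of)
-- Inf[S,j] for all j ≤ r, compute Inf[S, r+1]:
--   Act[S,r+1] = Inf[S,r]                    if r+1 ≤ λ
--              = Inf[S,r] \ Inf[S,r-λ]        if r+1 > λ
--   Inf[S,r+1] = Inf[S,r] ∪ { v : |N(v) ∩ Act[S,r+1]| ≥ t(v) }
actStep : ∀ {n} → ℕ → (ℕ → Fin n → Bool) → ℕ → Fin n → Bool
actStep λw f r u = if suc r ≤ᵇ λw then f r u else (f r u ∧ not (f (r ∸ λw) u))

infStep : ∀ {n} → Adj n → (Fin n → ℕ) → ℕ → (ℕ → Fin n → Bool) → ℕ → Fin n → Bool
infStep adj t λw f r v = f r v ∨ (t v ≤ᵇ countNbr adj (actStep λw f r) v)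

-- infUpTo r j = Inf[S, j] for every j ≤ r (values for j > r are irrelevant)
infUpTo : ∀ {n} → Adj n → (Fin n → ℕ) → ℕ → Subset n → ℕ → ℕ → Fin n → Bool
infUpTo adj t λw S zero j v = lookup S v
infUpTo adj t λw S (suc r) j v =
  if j ≤ᵇ r then infUpTo adj t λw S r j v
  else infStep adj t λw (infUpTo adj t λw S r) r v

Inf : ∀ {n} → Adj n → (Fin n → ℕ) → ℕ → Subset n → ℕ → Fin n → Bool
Inf adj t λw S r = infUpTo adj t λw S r r

IsTWCTarget : ∀ {n} → Adj n → (Fin n → ℕ) → ℕ → Subset n → Set
IsTWCTarget adj t λw S = ∃ λ r → ∀ v → Inf adj t λw S r v ≡ true

IsMinTWCTarget : ∀ {n} → Adj n → (Fin n → ℕ) → ℕ → Subset n → Set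
IsMinTWCTarget {n} adj t λw S =
  IsTWCTarget adj t λw S × (∀ (S' : Subset n) → IsTWCTarget adj t λw S' → ∣ S ∣ ≤ ∣ S' ∣)

pathAdj : (n : ℕ) → Adj n
pathAdj n i j = (toℕ j ≡ᵇ suc (toℕ i)) ∨ (toℕ i ≡ᵇ suc (toℕ j))

module Submission where

open import Defs
open import Data.Nat using (ℕ; _≤_; _<_)
open import Data.Fin using (Fin; toℕ)
open import Data.Fin.Subset using (Subset; _∈_; _∉_)
open import Data.Product using (∃; _×_)
open import Relation.Binary.PropositionalEquality using (_≡_; _≢_)

open import Data.Nat using (zero; suc; _+_; _*_; _∸_; _≤ᵇ_; _≡ᵇ_; z≤n; s≤s; z<s; _≤?_; _<?_;
                            _≤′_; ≤′-refl; ≤′-step)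
open import Data.Nat.Properties
open import Data.Nat.Induction using (<-rec)
open import Data.Nat.ListAction using (sum)
open import Data.Bool using (Bool; true; false; _∧_; _∨_; not; if_then_else_)
open import Data.Bool.Properties using (T-≡; if-cong; ∨-zeroʳ; ∨-identityʳ; ∧-inverseʳ; ¬-not)
  renaming (_≟_ to _≟ᵇ_)
import Data.Fin as Fin
open import Data.Fin using (fromℕ<)
open import Data.Fin.Properties using (all?; any?; ¬∀⟶∃¬; toℕ-injective; toℕ<n; toℕ-fromℕ<)
open import Data.Fin.Subset using (_⊆_; _∪_; _∩_; ⁅_⁆; ⊤; ∣_∣; Nonempty; inside; outside)
  renaming (⊥ to ∅)
open import Data.Fin.Subset.Properties
  using (p⊆q⇒∣p∣≤∣q∣; p⊂q⇒∣p∣<∣q∣; ∣p∣≤n; ∣⊥∣≡0; ∈⊤; ∣⁅x⁆∣≡1; x∈⁅x⁆; x∈⁅y⁆⇒x≡y; nonempty?; _∈?_;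
         anySubset?; x∈p∪q⁺; x∈p∪q⁻; x∈p∩q⁺; x∈p∩q⁻; p∩q⊆p; p∩q⊆q)
open import Data.Vec using ([]; _∷_; lookup; tabulate)
open import Data.Vec.Properties using (lookup∘tabulate; []=⇒lookup; lookup⇒[]=)
import Data.List as List
open import Data.List.Properties using (map-tabulate)
open import Data.Product using (_,_; proj₁; proj₂)
open import Data.Sum using (_⊎_; inj₁; inj₂)
import Data.Sum as Sum
open import Function.Bundles using (Equivalence)
open import Relation.Nullary using (¬_; ¬?; Dec; yes; no; does; contradiction; _×-dec_)
open import Relation.Nullary.Decidable using (dec-true)
open import Relation.Unary using (Decidable)
open import Relation.Binary.PropositionalEquality using (refl; sym; trans; cong; cong₂; subst; module ≡-Reasoning)

-- Take any minimum target set S₀ and its normal form S′ = (S₀ ∩ [ℓ,s]) ∪ {ℓ,s}.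
-- * Outside [ℓ,s] all thresholds are 1, so infection runs from ℓ and s outwards.
-- * A node v of [ℓ,s] lying between two seeds of S₀ is infected by S′ exactly as
--   by S₀ (locality).  Otherwise, say no seed of S₀ lies in [ℓ,v]; then all nodes
--   of (ℓ,v] have threshold 1, since a threshold-2 node y there would wall off the
--   seedless interval [ℓ,y], which S₀ could never infect; so infection runs from ℓ.
-- * |S′| ≤ |S₀|: if ℓ ∉ S₀, the same walling argument yields a seed left of ℓ,
--   which pays for ℓ; likewise for s.
-- The file develops: counting facts for finite sets and neighbourhoods; the TWC
-- process on any graph (recursion, spreading, shielded sets, locality, and
-- termination, which gives a minimum target set); walled intervals and spreading
-- on the path; the normal form S′; finally the theorem.

≤ᵇ-true : ∀ {m n} → m ≤ n → (m ≤ᵇ n) ≡ true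
≤ᵇ-true m≤n = Equivalence.to T-≡ (≤⇒≤ᵇ m≤n)

≤ᵇ-false : ∀ {m n} → n < m → (m ≤ᵇ n) ≡ false
≤ᵇ-false {m} {n} n<m with m ≤ᵇ n in eq
... | false = refl
... | true  = contradiction (≤ᵇ⇒≤ m n (Equivalence.from T-≡ eq)) (<⇒≱ n<m)

≡ᵇ-sound : ∀ {m n} → (m ≡ᵇ n) ≡ true → m ≡ n
≡ᵇ-sound {m} {n} eq = ≡ᵇ⇒≡ m n (Equivalence.from T-≡ eq)

≡ᵇ-true : ∀ {m n} → m ≡ n → (m ≡ᵇ n) ≡ true
≡ᵇ-true {m} {n} m≡n = Equivalence.to T-≡ (≡⇒≡ᵇ m n m≡n)

∧-true⁻ : ∀ {a b} → (a ∧ b) ≡ true → a ≡ true × b ≡ true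
∧-true⁻ {true} b≡true = refl , b≡true

∨-true⁻ : ∀ {a b} → (a ∨ b) ≡ true → a ≡ true ⊎ b ≡ true
∨-true⁻ {true}  _      = inj₁ refl
∨-true⁻ {false} b≡true = inj₂ b≡true

⇔ᵇ⇒≡ : ∀ {a b} → (a ≡ true → b ≡ true) → (b ≡ true → a ≡ true) → a ≡ b
⇔ᵇ⇒≡ {false} {false} _ _ = refl
⇔ᵇ⇒≡ {false} {true}  _ b⇒a = b⇒a refl
⇔ᵇ⇒≡ {true}          a⇒b _ = sym (a⇒b refl)

contraposeᵇ : ∀ {a b} → (a ≡ true → b ≡ true) → b ≡ false → a ≡ false
contraposeᵇ {false} _   _      = refl
contraposeᵇ {true}  a⇒b b≡false = trans (sym (a⇒b refl)) b≡false

outsideᵇ : ∀ {A : Set} {U : A → Set} → Decidable U → A → Bool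
outsideᵇ U? x = not (does (U? x))

outsideᵇ⁺ : ∀ {A : Set} {U : A → Set} (U? : Decidable U) {x} → ¬ U x → outsideᵇ U? x ≡ true
outsideᵇ⁺ U? {x} ¬Ux with U? x
... | yes Ux = contradiction Ux ¬Ux
... | no  _  = refl

outsideᵇ⁻ : ∀ {A : Set} {U : A → Set} (U? : Decidable U) {x} → outsideᵇ U? x ≡ true → ¬ U x
outsideᵇ⁻ U? {x} out with U? x
... | no ¬Ux = ¬Ux

∉⇒lookup : ∀ {n} {S : Subset n} {v} → v ∉ S → lookup S v ≡ false
∉⇒lookup {S = S} {v} v∉S with lookup S v in eq
... | false = refl
... | true  = contradiction (lookup⇒[]= v S eq) v∉S

∈-tabulate⁺ : ∀ {n} {f : Fin n → Bool} {x} → f x ≡ true → x ∈ tabulate f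
∈-tabulate⁺ {f = f} {x} fx = lookup⇒[]= x (tabulate f) (trans (lookup∘tabulate f x) fx)

∈-tabulate⁻ : ∀ {n} {f : Fin n → Bool} {x} → x ∈ tabulate f → f x ≡ true
∈-tabulate⁻ {f = f} {x} x∈ = trans (sym (lookup∘tabulate f x)) ([]=⇒lookup x∈)

⟦_⟧ : ∀ {n} {P : Fin n → Set} → Decidable P → Subset n
⟦ P? ⟧ = tabulate (λ x → does (P? x))

∈⟦⟧⁺ : ∀ {n} {P : Fin n → Set} (P? : Decidable P) {x} → P x → x ∈ ⟦ P? ⟧
∈⟦⟧⁺ P? {x} Px = ∈-tabulate⁺ (dec-true (P? x) Px)

∈⟦⟧⁻ : ∀ {n} {P : Fin n → Set} (P? : Decidable P) {x} → x ∈ ⟦ P? ⟧ → P x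
∈⟦⟧⁻ P? {x} x∈ with P? x | ∈-tabulate⁻ {f = λ y → does (P? y)} x∈
... | yes Px | _ = Px

∣p∣+∣q∣≡∣p∪q∣+∣p∩q∣ : ∀ {n} (p q : Subset n) → ∣ p ∣ + ∣ q ∣ ≡ ∣ p ∪ q ∣ + ∣ p ∩ q ∣
∣p∣+∣q∣≡∣p∪q∣+∣p∩q∣ []            []            = refl
∣p∣+∣q∣≡∣p∪q∣+∣p∩q∣ (outside ∷ p) (outside ∷ q) = ∣p∣+∣q∣≡∣p∪q∣+∣p∩q∣ p q
∣p∣+∣q∣≡∣p∪q∣+∣p∩q∣ (outside ∷ p) (inside  ∷ q) =
  trans (+-suc ∣ p ∣ ∣ q ∣) (cong suc (∣p∣+∣q∣≡∣p∪q∣+∣p∩q∣ p q))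
∣p∣+∣q∣≡∣p∪q∣+∣p∩q∣ (inside  ∷ p) (outside ∷ q) = cong suc (∣p∣+∣q∣≡∣p∪q∣+∣p∩q∣ p q)
∣p∣+∣q∣≡∣p∪q∣+∣p∩q∣ (inside  ∷ p) (inside  ∷ q) = cong suc (begin
  ∣ p ∣ + suc ∣ q ∣          ≡⟨ +-suc ∣ p ∣ ∣ q ∣ ⟩
  suc (∣ p ∣ + ∣ q ∣)         ≡⟨ cong suc (∣p∣+∣q∣≡∣p∪q∣+∣p∩q∣ p q) ⟩
  suc (∣ p ∪ q ∣ + ∣ p ∩ q ∣) ≡⟨ +-suc ∣ p ∪ q ∣ ∣ p ∩ q ∣ ⟨
  ∣ p ∪ q ∣ + suc ∣ p ∩ q ∣   ∎)
  where open ≡-Reasoning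

∣p∪q∣≤∣p∣+∣q∣ : ∀ {n} (p q : Subset n) → ∣ p ∪ q ∣ ≤ ∣ p ∣ + ∣ q ∣
∣p∪q∣≤∣p∣+∣q∣ p q = ≤-trans (m≤m+n ∣ p ∪ q ∣ ∣ p ∩ q ∣) (≤-reflexive (sym (∣p∣+∣q∣≡∣p∪q∣+∣p∩q∣ p q)))

∣∅∣ : ∀ {n} {p : Subset n} → (∀ {x} → x ∉ p) → ∣ p ∣ ≡ 0
∣∅∣ {n} empty =
  n≤0⇒n≡0 (≤-trans (p⊆q⇒∣p∣≤∣q∣ {q = ∅} (λ x∈p → contradiction x∈p empty)) (≤-reflexive (∣⊥∣≡0 n)))

disjoint⇒∣p∣+∣q∣≡∣p∪q∣ : ∀ {n} (p q : Subset n) → (∀ {x} → x ∈ p → x ∉ q) → ∣ p ∣ + ∣ q ∣ ≡ ∣ p ∪ q ∣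
disjoint⇒∣p∣+∣q∣≡∣p∪q∣ p q disjoint = begin
  ∣ p ∣ + ∣ q ∣         ≡⟨ ∣p∣+∣q∣≡∣p∪q∣+∣p∩q∣ p q ⟩
  ∣ p ∪ q ∣ + ∣ p ∩ q ∣ ≡⟨ cong (∣ p ∪ q ∣ +_) (∣∅∣ λ x∈p∩q → disjoint (p∩q⊆p p q x∈p∩q) (p∩q⊆q p q x∈p∩q)) ⟩
  ∣ p ∪ q ∣ + 0         ≡⟨ +-identityʳ _ ⟩
  ∣ p ∪ q ∣             ∎
  where open ≡-Reasoning

∣p∣≤1 : ∀ {n} {p : Subset n} → (∀ {x y} → x ∈ p → y ∈ p → x ≡ y) → ∣ p ∣ ≤ 1
∣p∣≤1 {p = p} unique with nonempty? p
... | yes (x , x∈p) = ≤-trans (p⊆q⇒∣p∣≤∣q∣ (λ y∈p → subst (_∈ ⁅ x ⁆) (unique x∈p y∈p) (x∈⁅x⁆ x)))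
                             (≤-reflexive (∣⁅x⁆∣≡1 x))
... | no  empty      = ≤-trans (≤-reflexive (∣∅∣ λ x∈p → empty (_ , x∈p))) z≤n

∈⇒1≤∣p∣ : ∀ {n} {p : Subset n} {x} → x ∈ p → 1 ≤ ∣ p ∣
∈⇒1≤∣p∣ {x = x} x∈p =
  ≤-trans (≤-reflexive (sym (∣⁅x⁆∣≡1 x))) (p⊆q⇒∣p∣≤∣q∣ (λ y∈⁅x⁆ → subst (_∈ _) (sym (x∈⁅y⁆⇒x≡y x y∈⁅x⁆)) x∈p))

∣p∪⁅x⁆∣≤∣p∣+∣q∣ : ∀ {n} {p q : Subset n} {x} → x ∈ p ⊎ Nonempty q → ∣ p ∪ ⁅ x ⁆ ∣ ≤ ∣ p ∣ + ∣ q ∣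
∣p∪⁅x⁆∣≤∣p∣+∣q∣ {p = p} {q} {x} (inj₁ x∈p) =
  ≤-trans (p⊆q⇒∣p∣≤∣q∣ absorb) (m≤m+n ∣ p ∣ ∣ q ∣)
  where
  absorb : p ∪ ⁅ x ⁆ ⊆ p
  absorb y∈ with x∈p∪q⁻ p ⁅ x ⁆ y∈
  ... | inj₁ y∈p   = y∈p
  ... | inj₂ y∈⁅x⁆ = subst (_∈ p) (sym (x∈⁅y⁆⇒x≡y x y∈⁅x⁆)) x∈p
∣p∪⁅x⁆∣≤∣p∣+∣q∣ {p = p} {q} {x} (inj₂ (_ , y∈q)) = begin
  ∣ p ∪ ⁅ x ⁆ ∣     ≤⟨ ∣p∪q∣≤∣p∣+∣q∣ p ⁅ x ⁆ ⟩
  ∣ p ∣ + ∣ ⁅ x ⁆ ∣ ≡⟨ cong (∣ p ∣ +_) (∣⁅x⁆∣≡1 x) ⟩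
  ∣ p ∣ + 1         ≤⟨ +-monoʳ-≤ ∣ p ∣ (∈⇒1≤∣p∣ y∈q) ⟩
  ∣ p ∣ + ∣ q ∣     ∎
  where open ≤-Reasoning

nbrs : ∀ {n} → Adj n → (Fin n → Bool) → Fin n → Subset n
nbrs adj P v = tabulate (λ u → adj v u ∧ P u)

∈-nbrs⁺ : ∀ {n} (adj : Adj n) P {v u} → adj v u ≡ true → P u ≡ true → u ∈ nbrs adj P v
∈-nbrs⁺ adj P {v} {u} adj≡true P≡true = ∈-tabulate⁺ (trans (cong (_∧ P u) adj≡true) P≡true)

∈-nbrs⁻ : ∀ {n} (adj : Adj n) P {v u} → u ∈ nbrs adj P v → adj v u ≡ true × P u ≡ true
∈-nbrs⁻ adj P u∈ = ∧-true⁻ (∈-tabulate⁻ u∈)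

countNbr≡∣nbrs∣ : ∀ {n} (adj : Adj n) P v → countNbr adj P v ≡ ∣ nbrs adj P v ∣
countNbr≡∣nbrs∣ adj P v =
  trans (cong sum (map-tabulate (λ u → u) (λ u → if adj v u ∧ P u then 1 else 0)))
        (sum-indicator (λ u → adj v u ∧ P u))
  where
  sum-indicator : ∀ {n} (f : Fin n → Bool) →
                  sum (List.tabulate (λ u → if f u then 1 else 0)) ≡ ∣ tabulate f ∣
  sum-indicator {zero}  f = refl
  sum-indicator {suc n} f with f Fin.zero
  ... | true  = cong suc (sum-indicator (λ u → f (Fin.suc u)))
  ... | false = sum-indicator (λ u → f (Fin.suc u))

countNbr-mono : ∀ {n} (adj : Adj n) {P Q} v → (∀ u → adj v u ≡ true → P u ≡ true → Q u ≡ true) →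
                countNbr adj P v ≤ countNbr adj Q v
countNbr-mono adj {P} {Q} v P⊆Q = begin
  countNbr adj P v   ≡⟨ countNbr≡∣nbrs∣ adj P v ⟩
  ∣ nbrs adj P v ∣   ≤⟨ p⊆q⇒∣p∣≤∣q∣ nbrs-P⊆nbrs-Q ⟩
  ∣ nbrs adj Q v ∣   ≡⟨ countNbr≡∣nbrs∣ adj Q v ⟨
  countNbr adj Q v   ∎
  where
  open ≤-Reasoning
  nbrs-P⊆nbrs-Q : nbrs adj P v ⊆ nbrs adj Q v
  nbrs-P⊆nbrs-Q u∈ = let adj≡ , P≡ = ∈-nbrs⁻ adj P u∈ in ∈-nbrs⁺ adj Q adj≡ (P⊆Q _ adj≡ P≡)

countNbr-cong : ∀ {n} (adj : Adj n) {P Q} v → (∀ u → adj v u ≡ true → P u ≡ Q u) →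
                countNbr adj P v ≡ countNbr adj Q v
countNbr-cong adj v P≡Q = ≤-antisym
  (countNbr-mono adj v λ u adj≡ P≡ → trans (sym (P≡Q u adj≡)) P≡)
  (countNbr-mono adj v λ u adj≡ Q≡ → trans (P≡Q u adj≡) Q≡)

countNbr-none : ∀ {n} (adj : Adj n) {P} v → (∀ u → adj v u ≡ true → P u ≡ false) → countNbr adj P v ≡ 0
countNbr-none adj {P} v none = trans (countNbr≡∣nbrs∣ adj P v) (∣∅∣ λ u∈ →
  let adj≡ , P≡ = ∈-nbrs⁻ adj P u∈ in contradiction (trans (sym P≡) (none _ adj≡)) λ ())

countNbr-≥1 : ∀ {n} (adj : Adj n) {P} v u → adj v u ≡ true → P u ≡ true → 1 ≤ countNbr adj P v
countNbr-≥1 adj {P} v u adj≡ P≡ =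
  subst (1 ≤_) (sym (countNbr≡∣nbrs∣ adj P v)) (∈⇒1≤∣p∣ (∈-nbrs⁺ adj P adj≡ P≡))

countNbr-≤1 : ∀ {n} (adj : Adj n) {P} v →
              (∀ u w → adj v u ≡ true → P u ≡ true → adj v w ≡ true → P w ≡ true → u ≡ w) →
              countNbr adj P v ≤ 1
countNbr-≤1 adj {P} v unique = subst (_≤ 1) (sym (countNbr≡∣nbrs∣ adj P v)) (∣p∣≤1 λ u∈ w∈ →
  let adj-u , P-u = ∈-nbrs⁻ adj P u∈ ; adj-w , P-w = ∈-nbrs⁻ adj P w∈ in unique _ _ adj-u P-u adj-w P-w)

module Process {n : ℕ} (adj : Adj n) (t : Fin n → ℕ) (λw : ℕ) where

  infected : Subset n → ℕ → Fin n → Bool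
  infected = Inf adj t λw

  -- active S r = Act[S,r+1]: the nodes able to infect their neighbours in round r+1
  active : Subset n → ℕ → Fin n → Bool
  active S = actStep λw (infected S)

  infUpTo-correct : ∀ S {r j} v → j ≤ r → infUpTo adj t λw S r j v ≡ infected S j v
  infUpTo-correct S {zero}      v z≤n = refl
  infUpTo-correct S {suc r} {j} v j≤1+r with j ≤? r
  ... | yes j≤r = trans (if-cong (≤ᵇ-true j≤r)) (infUpTo-correct S v j≤r)
  ... | no  j≰r rewrite ≤-antisym j≤1+r (≰⇒> j≰r) = refl

  infected-suc : ∀ S r v → infected S (suc r) v ≡ (infected S r v ∨ (t v ≤ᵇ countNbr adj (active S r) v))
  infected-suc S r v = trans (if-cong (≤ᵇ-false (n<1+n r)))
    (cong (λ c → infected S r v ∨ (t v ≤ᵇ c)) (countNbr-cong adj v λ u _ → table-active u))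
    where
    table-active : ∀ u → actStep λw (infUpTo adj t λw S r) r u ≡ active S r u
    table-active u with suc r ≤ᵇ λw
    ... | true  = refl
    ... | false = cong (λ b → infected S r u ∧ not b) (infUpTo-correct S u (m∸n≤m r λw))

  infected-step : ∀ S r v → infected S r v ≡ true → infected S (suc r) v ≡ true
  infected-step S r v inf = trans (infected-suc S r v) (cong (_∨ (t v ≤ᵇ countNbr adj (active S r) v)) inf)

  infected-mono : ∀ S r r′ v → r ≤ r′ → infected S r v ≡ true → infected S r′ v ≡ true
  infected-mono S r r′ v r≤r′ inf = go (≤⇒≤′ r≤r′)
    where
    go : ∀ {r′} → _ ≤′ r′ → infected S r′ v ≡ true
    go ≤′-refl      = inf
    go (≤′-step {r′} le) = infected-step S r′ v (go le)

  seed-infected : ∀ S r v → v ∈ S → infected S r v ≡ true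
  seed-infected S r v v∈S = infected-mono S 0 r v z≤n ([]=⇒lookup v∈S)

  active⇒infected : ∀ S r u → active S r u ≡ true → infected S r u ≡ true
  active⇒infected S r u act with suc r ≤ᵇ λw
  ... | true  = act
  ... | false = proj₁ (∧-true⁻ act)

  initially-active : 1 ≤ λw → ∀ S u → infected S 0 u ≡ true → active S 0 u ≡ true
  initially-active 1≤λ S u inf = trans (if-cong (≤ᵇ-true 1≤λ)) inf

  newly-infected-active : 1 ≤ λw → ∀ S r u → infected S (suc r) u ≡ true → infected S r u ≡ false →
                          active S (suc r) u ≡ true
  newly-infected-active 1≤λ S r u inf new with suc (suc r) ≤ᵇ λw
  ... | true  = inf
  ... | false = cong₂ (λ a b → a ∧ not b) inf not-yet
    where
    -- the window start suc r ∸ λ is at most r, when u was not yet infected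
    not-yet : infected S (suc r ∸ λw) u ≡ false
    not-yet = contraposeᵇ (infected-mono S (suc r ∸ λw) r u (∸-monoʳ-≤ (suc r) 1≤λ)) new

  infected-by-active : ∀ S r {u v} → active S r u ≡ true → adj v u ≡ true → t v ≤ 1 →
                       infected S (suc r) v ≡ true
  infected-by-active S r {u} {v} act adj≡ t≤1 = begin
    infected S (suc r) v                                  ≡⟨ infected-suc S r v ⟩
    infected S r v ∨ (t v ≤ᵇ countNbr adj (active S r) v) ≡⟨ cong (infected S r v ∨_) fires ⟩
    infected S r v ∨ true                                 ≡⟨ ∨-zeroʳ _ ⟩
    true                                                  ∎
    where
    open ≡-Reasoning
    fires : (t v ≤ᵇ countNbr adj (active S r) v) ≡ true
    fires = ≤ᵇ-true (≤-trans t≤1 (countNbr-≥1 adj v u adj≡ act))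

  spread-step : 1 ≤ λw → ∀ S r {u v} → infected S r u ≡ true → adj v u ≡ true → t v ≤ 1 →
                infected S (suc r) v ≡ true
  spread-step 1≤λ S zero    {u} inf adj≡ t≤1 =
    infected-by-active S 0 (initially-active 1≤λ S u inf) adj≡ t≤1
  spread-step 1≤λ S (suc r) {u} {v} inf adj≡ t≤1 with infected S r u ≟ᵇ true
  ... | yes before = infected-step S (suc r) v (spread-step 1≤λ S r before adj≡ t≤1)
  ... | no  new    = infected-by-active S (suc r) (newly-infected-active 1≤λ S r u inf (¬-not new)) adj≡ t≤1

  -- A seed-free set U in which every node v has fewer than t(v) neighbours
  -- outside U is never infected: its nodes only ever see active nodes outside U.
  shielded-uninfected : ∀ S {U} (U? : Decidable U) → (∀ v → U v → v ∉ S) →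
                        (∀ v → U v → countNbr adj (outsideᵇ U?) v < t v) →
                        ∀ r v → U v → infected S r v ≡ false
  shielded-uninfected S U? seedless shielded zero    v Uv = ∉⇒lookup (seedless v Uv)
  shielded-uninfected S U? seedless shielded (suc r) v Uv = begin
    infected S (suc r) v                                  ≡⟨ infected-suc S r v ⟩
    infected S r v ∨ (t v ≤ᵇ countNbr adj (active S r) v) ≡⟨ cong₂ _∨_ (IH v Uv) (≤ᵇ-false too-few) ⟩
    false                                                 ∎
    where
    open ≡-Reasoning
    IH = shielded-uninfected S U? seedless shielded r
    active-outside : ∀ u → active S r u ≡ true → outsideᵇ U? u ≡ true
    active-outside u act = outsideᵇ⁺ U? λ Uu →
      contradiction (trans (sym (active⇒infected S r u act)) (IH u Uu)) λ ()
    too-few : countNbr adj (active S r) v < t v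
    too-few = ≤-<-trans (countNbr-mono adj v λ u _ → active-outside u) (shielded v Uv)

  locality : ∀ S S′ (G : Fin n → Set) → (∀ v → G v → (v ∈ S → v ∈ S′) × (v ∈ S′ → v ∈ S)) →
             (∀ v u → G v → v ∉ S → adj v u ≡ true → G u) →
             ∀ r v → G v → infected S r v ≡ infected S′ r v
  locality S S′ G same-seeds closed = <-rec _ agree
    where
    agree : ∀ r → (∀ {j} → j < r → ∀ v → G v → infected S j v ≡ infected S′ j v) →
            ∀ v → G v → infected S r v ≡ infected S′ r v
    agree r IH v Gv with v ∈? S
    ... | yes v∈S = trans (seed-infected S r v v∈S) (sym (seed-infected S′ r v (proj₁ (same-seeds v Gv) v∈S)))
    agree zero    IH v Gv | no v∉S =
      trans (∉⇒lookup v∉S) (sym (∉⇒lookup λ v∈S′ → v∉S (proj₂ (same-seeds v Gv) v∈S′)))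
    agree (suc r) IH v Gv | no v∉S = begin
      infected S (suc r) v                                    ≡⟨ infected-suc S r v ⟩
      infected S r v ∨ (t v ≤ᵇ countNbr adj (active S r) v)   ≡⟨ cong₂ (λ b c → b ∨ (t v ≤ᵇ c))
                                                                   (IH ≤-refl v Gv) neighbours-agree ⟩
      infected S′ r v ∨ (t v ≤ᵇ countNbr adj (active S′ r) v) ≡⟨ infected-suc S′ r v ⟨
      infected S′ (suc r) v                                   ∎
      where
      open ≡-Reasoning
      same-activity : ∀ u → G u → active S r u ≡ active S′ r u
      same-activity u Gu with suc r ≤ᵇ λw
      ... | true  = IH ≤-refl u Gu
      ... | false = cong₂ (λ a b → a ∧ not b) (IH ≤-refl u Gu) (IH (s≤s (m∸n≤m r λw)) u Gu)
      neighbours-agree : countNbr adj (active S r) v ≡ countNbr adj (active S′ r) v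
      neighbours-agree = countNbr-cong adj v λ u adj≡ → same-activity u (closed v u Gv v∉S adj≡)

  -- With all thresholds ≥ 1, a window of λ rounds without change
  -- leaves no active node, so the infected set either freezes or grows in every
  -- window; after n+1 windows it is final.  Hence being a target set is
  -- decidable, and a minimum-size target set exists.
  module Settling (t≥1 : ∀ v → 1 ≤ t v) where

    Same : Subset n → ℕ → ℕ → Set
    Same S m m′ = ∀ v → infected S m v ≡ infected S m′ v

    Final : Subset n → ℕ → Set
    Final S m = ∀ r v → infected S r v ≡ true → infected S m v ≡ true

    -- A window [m, m+λ] without change leaves no active node, so nothing changes afterwards.
    quiescent : ∀ S m → (∀ j → j ≤ λw → Same S (m + j) m) → ∀ j → Same S (m + j) m
    quiescent S m window = <-rec _ step
      where
      step : ∀ j → (∀ {i} → i < j → Same S (m + i) m) → Same S (m + j) m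
      step j IH v with j ≤? λw
      ... | yes j≤λ = window j j≤λ v
      step zero    IH v | no 0≰λ   = contradiction z≤n 0≰λ
      step (suc i) IH v | no 1+i≰λ = begin
        infected S (m + suc i) v
          ≡⟨ cong (λ r → infected S r v) (+-suc m i) ⟩
        infected S (suc (m + i)) v
          ≡⟨ infected-suc S (m + i) v ⟩
        infected S (m + i) v ∨ (t v ≤ᵇ countNbr adj (active S (m + i)) v)
          ≡⟨ cong₂ (λ b c → b ∨ (t v ≤ᵇ c)) (IH ≤-refl v) (countNbr-none adj v λ u _ → inactive u) ⟩
        infected S m v ∨ (t v ≤ᵇ 0)
          ≡⟨ cong (infected S m v ∨_) (≤ᵇ-false (t≥1 v)) ⟩
        infected S m v ∨ false
          ≡⟨ ∨-identityʳ _ ⟩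
        infected S m v
          ∎
        where
        open ≡-Reasoning
        λ≤i : λw ≤ i
        λ≤i = ≤-pred (≰⇒> 1+i≰λ)
        -- everything active after m+λ was infected within the frozen period
        inactive : ∀ u → active S (m + i) u ≡ false
        inactive u = begin
          active S (m + i) u
            ≡⟨ if-cong (≤ᵇ-false (s≤s (≤-trans λ≤i (m≤n+m i m)))) ⟩
          infected S (m + i) u ∧ not (infected S (m + i ∸ λw) u)
            ≡⟨ cong₂ (λ a b → a ∧ not b) (IH ≤-refl u) earlier ⟩
          infected S m u ∧ not (infected S m u)
            ≡⟨ ∧-inverseʳ (infected S m u) ⟩
          false
            ∎
          where
          earlier : infected S (m + i ∸ λw) u ≡ infected S m u
          earlier = trans (cong (λ r → infected S r u) (+-∸-assoc m λ≤i)) (IH (s≤s (m∸n≤m i λw)) u)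

    -- If Inf[S,m+λ] = Inf[S,m] then, by monotonicity, the whole window is unchanged.
    frozen⇒final : ∀ S m → Same S (m + λw) m → Final S m
    frozen⇒final S m frozen r v inf =
      trans (sym (quiescent S m window r v)) (infected-mono S r (m + r) v (m≤n+m r m) inf)
      where
      window : ∀ j → j ≤ λw → Same S (m + j) m
      window j j≤λ u = ⇔ᵇ⇒≡
        (λ inf′ → trans (sym (frozen u)) (infected-mono S (m + j) (m + λw) u (+-monoʳ-≤ m j≤λ) inf′))
        (infected-mono S m (m + j) u (m≤m+n m j))

    final-mono : ∀ S {m m′} → m ≤ m′ → Final S m → Final S m′
    final-mono S {m} {m′} m≤m′ final r v inf = infected-mono S m m′ v m≤m′ (final r v inf)

    frozen-or-grows : ∀ S m → Same S (m + λw) m ⊎ ∣ tabulate (infected S m) ∣ < ∣ tabulate (infected S (m + λw)) ∣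
    frozen-or-grows S m with all? (λ v → infected S (m + λw) v ≟ᵇ infected S m v)
    ... | yes same = inj₁ same
    ... | no ¬same with ¬∀⟶∃¬ n _ (λ v → infected S (m + λw) v ≟ᵇ infected S m v) ¬same
    ... | v , changed = inj₂ (p⊂q⇒∣p∣<∣q∣ (grows , v , ∈-tabulate⁺ new , v∉old))
      where
      grows : tabulate (infected S m) ⊆ tabulate (infected S (m + λw))
      grows x∈ = ∈-tabulate⁺ (infected-mono S m (m + λw) _ (m≤m+n m λw) (∈-tabulate⁻ x∈))
      old : infected S m v ≡ false
      old = ¬-not λ inf → changed (trans (infected-mono S m (m + λw) v (m≤m+n m λw) inf) (sym inf))
      v∉old : v ∉ tabulate (infected S m)
      v∉old v∈ = contradiction (trans (sym (∈-tabulate⁻ v∈)) old) λ ()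
      new : infected S (m + λw) v ≡ true
      new = ¬-not λ notnew → changed (trans notnew (sym old))

    progress : ∀ S k → k ≤ ∣ tabulate (infected S (k * λw)) ∣ ⊎ Final S (k * λw)
    progress S zero = inj₁ z≤n
    progress S (suc k) with progress S k
    ... | inj₂ final = inj₂ (final-mono S (m≤n+m (k * λw) λw) final)
    ... | inj₁ k≤∣Inf∣ with frozen-or-grows S (k * λw)
    ...   | inj₁ frozen = inj₂ (final-mono S (m≤n+m (k * λw) λw) (frozen⇒final S (k * λw) frozen))
    ...   | inj₂ grows  = inj₁ (subst (λ r → suc k ≤ ∣ tabulate (infected S r) ∣) (+-comm (k * λw) λw)
                                      (≤-<-trans k≤∣Inf∣ grows))

    settled : ℕ
    settled = suc n * λw

    settled-final : ∀ S → Final S settled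
    settled-final S with progress S (suc n)
    ... | inj₂ final  = final
    ... | inj₁ n<∣Inf∣ = contradiction (∣p∣≤n (tabulate (infected S settled))) (<⇒≱ n<∣Inf∣)

    target-if-all-infected : ∀ S → (∀ v → ∃ λ r → infected S r v ≡ true) → IsTWCTarget adj t λw S
    target-if-all-infected S all = settled , λ v → settled-final S (proj₁ (all v)) v (proj₂ (all v))

    -- being a target set amounts to infecting every node by round settled
    target? : ∀ S → Dec (IsTWCTarget adj t λw S)
    target? S with all? (λ v → infected S settled v ≟ᵇ true)
    ... | yes all = yes (settled , all)
    ... | no ¬all = no λ (r , all) → ¬all λ v → settled-final S r v (all v)

    minimum-target : ∀ k → (∃ λ S → IsTWCTarget adj t λw S × ∣ S ∣ ≤ k) → ∃ λ S → IsMinTWCTarget adj t λw S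
    minimum-target zero    (S , target , ∣S∣≤0)   = S , target , λ _ _ → ≤-trans ∣S∣≤0 z≤n
    minimum-target (suc k) (S , target , ∣S∣≤1+k) with anySubset? (λ S′ → target? S′ ×-dec (∣ S′ ∣ ≤? k))
    ... | yes smaller = minimum-target k smaller
    ... | no  none    = S , target , λ S′ target′ →
      ≤-trans ∣S∣≤1+k (≰⇒> λ ∣S′∣≤k → none (S′ , target′ , ∣S′∣≤k))

pathAdj⇒ : ∀ {n} {v u : Fin n} → pathAdj n v u ≡ true → toℕ u ≡ suc (toℕ v) ⊎ toℕ v ≡ suc (toℕ u)
pathAdj⇒ adj≡ = Sum.map ≡ᵇ-sound ≡ᵇ-sound (∨-true⁻ adj≡)

pathAdj-next : ∀ {n} {v u : Fin n} → toℕ u ≡ suc (toℕ v) → pathAdj n v u ≡ true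
pathAdj-next {v = v} {u} u≡1+v = cong (_∨ (toℕ v ≡ᵇ suc (toℕ u))) (≡ᵇ-true u≡1+v)

pathAdj-prev : ∀ {n} {v u : Fin n} → toℕ v ≡ suc (toℕ u) → pathAdj n v u ≡ true
pathAdj-prev {v = v} {u} v≡1+u = trans (cong ((toℕ u ≡ᵇ suc (toℕ v)) ∨_) (≡ᵇ-true v≡1+u)) (∨-zeroʳ _)

path-deg≤2 : ∀ {n} (v : Fin n) → deg (pathAdj n) v ≤ 2
path-deg≤2 {n} v = begin
  deg (pathAdj n) v                   ≡⟨ countNbr≡∣nbrs∣ (pathAdj n) _ v ⟩
  ∣ nbrs (pathAdj n) (λ _ → true) v ∣ ≤⟨ p⊆q⇒∣p∣≤∣q∣ nbrs⊆ ⟩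
  ∣ next ∪ prev ∣                     ≤⟨ ∣p∪q∣≤∣p∣+∣q∣ next prev ⟩
  ∣ next ∣ + ∣ prev ∣                 ≤⟨ +-mono-≤ (∣p∣≤1 next-unique) (∣p∣≤1 prev-unique) ⟩
  2                                   ∎
  where
  open ≤-Reasoning
  next prev : Subset n
  next = tabulate λ u → toℕ u ≡ᵇ suc (toℕ v)
  prev = tabulate λ u → toℕ v ≡ᵇ suc (toℕ u)
  nbrs⊆ : nbrs (pathAdj n) (λ _ → true) v ⊆ next ∪ prev
  nbrs⊆ u∈ = x∈p∪q⁺ (Sum.map ∈-tabulate⁺ ∈-tabulate⁺ (∨-true⁻ (proj₁ (∈-nbrs⁻ (pathAdj n) _ u∈))))
  next-unique : ∀ {x y} → x ∈ next → y ∈ next → x ≡ y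
  next-unique x∈ y∈ = toℕ-injective (trans (≡ᵇ-sound (∈-tabulate⁻ x∈)) (sym (≡ᵇ-sound (∈-tabulate⁻ y∈))))
  prev-unique : ∀ {x y} → x ∈ prev → y ∈ prev → x ≡ y
  prev-unique x∈ y∈ =
    toℕ-injective (suc-injective (trans (sym (≡ᵇ-sound {toℕ v} (∈-tabulate⁻ x∈))) (≡ᵇ-sound {toℕ v} (∈-tabulate⁻ y∈))))

path-deg-first : ∀ {n} (v : Fin n) → toℕ v ≡ 0 → deg (pathAdj n) v ≤ 1
path-deg-first {n} v v≡0 = countNbr-≤1 (pathAdj n) v λ u w u~v _ w~v _ →
  toℕ-injective (trans (index-one u u~v) (sym (index-one w w~v)))
  where
  index-one : ∀ u → pathAdj n v u ≡ true → toℕ u ≡ 1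
  index-one u adj≡ with pathAdj⇒ adj≡
  ... | inj₁ u≡1+v = trans u≡1+v (cong suc v≡0)
  ... | inj₂ v≡1+u = contradiction (trans (sym v≡1+u) v≡0) λ ()

module OnPath {n : ℕ} (t : Fin n → ℕ) (λw : ℕ) where
  open Process (pathAdj n) t λw

  Between : ℕ → ℕ → Fin n → Set
  Between a b x = a ≤ toℕ x × toℕ x ≤ b

  between? : ∀ a b → Decidable (Between a b)
  between? a b x = (a ≤? toℕ x) ×-dec (toℕ x ≤? b)

  exit : ∀ {a b x u} → Between a b x → pathAdj n x u ≡ true → ¬ Between a b u →
         (toℕ x ≡ a × toℕ x ≡ suc (toℕ u)) ⊎ (toℕ x ≡ b × toℕ u ≡ suc (toℕ x))
  exit {a} {b} {x} {u} (a≤x , x≤b) adj≡ u∉ with pathAdj⇒ adj≡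
  ... | inj₁ u≡1+x = inj₂ (≤-antisym x≤b (≤-pred (subst (b <_) u≡1+x b<u)) , u≡1+x)
    where
    b<u : b < toℕ u
    b<u = ≰⇒> λ u≤b → u∉ (≤-trans a≤x (≤-trans (n≤1+n _) (≤-reflexive (sym u≡1+x))) , u≤b)
  ... | inj₂ x≡1+u = inj₁ (≤-antisym (subst (_≤ a) (sym x≡1+u) u<a) a≤x , x≡1+u)
    where
    u<a : toℕ u < a
    u<a = ≰⇒> λ a≤u → u∉ (a≤u , ≤-trans (n≤1+n _) (≤-trans (≤-reflexive (sym x≡1+u)) x≤b))

  interval-shielded : ∀ {a b} → a < b → (∀ v → 1 ≤ t v) →
                      (∀ y → toℕ y ≡ a → 0 < a → 2 ≤ t y) → (∀ y → toℕ y ≡ b → suc b < n → 2 ≤ t y) →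
                      ∀ x → Between a b x → countNbr (pathAdj n) (outsideᵇ (between? a b)) x < t x
  interval-shielded {a} {b} a<b t≥1 left-wall right-wall x x∈
    with any? (λ u → (pathAdj n x u ≟ᵇ true) ×-dec ¬? (between? a b u))
  ... | yes (u , adj≡ , u∉) = <-≤-trans (s≤s (countNbr-≤1 (pathAdj n) x unique)) (at-wall u adj≡ u∉)
    where
    at-wall : ∀ u → pathAdj n x u ≡ true → ¬ Between a b u → 2 ≤ t x
    at-wall u adj≡ u∉ with exit x∈ adj≡ u∉
    ... | inj₁ (x≡a , x≡1+u) = left-wall x x≡a (subst (0 <_) (trans (sym x≡1+u) x≡a) z<s)
    ... | inj₂ (x≡b , u≡1+x) = right-wall x x≡b (subst (_< n) (trans u≡1+x (cong suc x≡b)) (toℕ<n u))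
    unique : ∀ u w → pathAdj n x u ≡ true → outsideᵇ (between? a b) u ≡ true →
             pathAdj n x w ≡ true → outsideᵇ (between? a b) w ≡ true → u ≡ w
    unique u w u~x u-out w~x w-out
      with exit x∈ u~x (outsideᵇ⁻ (between? a b) u-out) | exit x∈ w~x (outsideᵇ⁻ (between? a b) w-out)
    ... | inj₁ (_ , x≡1+u) | inj₁ (_ , x≡1+w) = toℕ-injective (suc-injective (trans (sym x≡1+u) x≡1+w))
    ... | inj₂ (_ , u≡1+x) | inj₂ (_ , w≡1+x) = toℕ-injective (trans u≡1+x (sym w≡1+x))
    ... | inj₁ (x≡a , _)   | inj₂ (x≡b , _)   = contradiction (trans (sym x≡a) x≡b) (<⇒≢ a<b)
    ... | inj₂ (x≡b , _)   | inj₁ (x≡a , _)   = contradiction (trans (sym x≡a) x≡b) (<⇒≢ a<b)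
  ... | no none = <-≤-trans (s≤s (≤-reflexive (countNbr-none (pathAdj n) x neighbours-inside))) (t≥1 x)
    where
    neighbours-inside : ∀ u → pathAdj n x u ≡ true → outsideᵇ (between? a b) u ≡ false
    neighbours-inside u adj≡ = ¬-not λ out → none (u , adj≡ , outsideᵇ⁻ (between? a b) out)

  interval-seed : ∀ S {a b} → a < b → (∀ v → 1 ≤ t v) →
                  (∀ y → toℕ y ≡ a → 0 < a → 2 ≤ t y) → (∀ y → toℕ y ≡ b → suc b < n → 2 ≤ t y) →
                  ∀ r x → Between a b x → infected S r x ≡ true → ∃ λ y → y ∈ S × Between a b y
  interval-seed S {a} {b} a<b t≥1 left-wall right-wall r x x∈ inf
    with any? (λ y → (y ∈? S) ×-dec between? a b y)
  ... | yes seed = seed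
  ... | no  none = contradiction (trans (sym inf) never) λ ()
    where
    never : infected S r x ≡ false
    never = shielded-uninfected S (between? a b) (λ y y∈ y∈S → none (y , y∈S , y∈))
              (interval-shielded a<b t≥1 left-wall right-wall) r x x∈

  spread-right : 1 ≤ λw → ∀ S o → o ∈ S → ∀ d x → toℕ x ≡ toℕ o + d →
                 (∀ y → toℕ o < toℕ y → toℕ y ≤ toℕ x → t y ≤ 1) → infected S d x ≡ true
  spread-right 1≤λ S o o∈S zero x x≡o _ =
    seed-infected S 0 x (subst (_∈ S) (toℕ-injective (sym (trans x≡o (+-identityʳ _)))) o∈S)
  spread-right 1≤λ S o o∈S (suc d) x x≡o+1+d light =
    spread-step 1≤λ S d (spread-right 1≤λ S o o∈S d y y≡o+d light-y) (pathAdj-prev x≡1+y) (light x o<x ≤-refl)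
    where
    x≡1+o+d : toℕ x ≡ suc (toℕ o + d)
    x≡1+o+d = trans x≡o+1+d (+-suc (toℕ o) d)
    y : Fin n
    y = fromℕ< (<-trans (≤-reflexive (sym x≡1+o+d)) (toℕ<n x))
    y≡o+d : toℕ y ≡ toℕ o + d
    y≡o+d = toℕ-fromℕ< _
    x≡1+y : toℕ x ≡ suc (toℕ y)
    x≡1+y = trans x≡1+o+d (cong suc (sym y≡o+d))
    o<x : toℕ o < toℕ x
    o<x = ≤-trans (s≤s (m≤m+n (toℕ o) d)) (≤-reflexive (sym x≡1+o+d))
    light-y : ∀ z → toℕ o < toℕ z → toℕ z ≤ toℕ y → t z ≤ 1
    light-y z o<z z≤y = light z o<z (≤-trans z≤y (≤-trans (n≤1+n _) (≤-reflexive (sym x≡1+y))))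

  spread-left : 1 ≤ λw → ∀ S o → o ∈ S → ∀ d x → toℕ x + d ≡ toℕ o →
                (∀ y → toℕ x ≤ toℕ y → toℕ y < toℕ o → t y ≤ 1) → infected S d x ≡ true
  spread-left 1≤λ S o o∈S zero x x≡o _ =
    seed-infected S 0 x (subst (_∈ S) (toℕ-injective (sym (trans (sym (+-identityʳ _)) x≡o))) o∈S)
  spread-left 1≤λ S o o∈S (suc d) x x+1+d≡o light =
    spread-step 1≤λ S d (spread-left 1≤λ S o o∈S d y y+d≡o light-y) (pathAdj-next y≡1+x) (light x ≤-refl x<o)
    where
    x<o : toℕ x < toℕ o
    x<o = ≤-trans (s≤s (m≤m+n (toℕ x) d)) (≤-reflexive (trans (sym (+-suc (toℕ x) d)) x+1+d≡o))
    y : Fin n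
    y = fromℕ< (≤-<-trans x<o (toℕ<n o))
    y≡1+x : toℕ y ≡ suc (toℕ x)
    y≡1+x = toℕ-fromℕ< _
    y+d≡o : toℕ y + d ≡ toℕ o
    y+d≡o = trans (cong (_+ d) y≡1+x) (trans (sym (+-suc (toℕ x) d)) x+1+d≡o)
    light-y : ∀ z → toℕ y ≤ toℕ z → toℕ z < toℕ o → t z ≤ 1
    light-y z y≤z z<o = light z (≤-trans (n≤1+n _) (≤-trans (≤-reflexive (sym y≡1+x)) y≤z)) z<o

module NormalForm (λw : ℕ) (1≤λ : 1 ≤ λw) (n : ℕ) (t : Fin n → ℕ)
  (t≥1 : ∀ v → 1 ≤ t v) (t≤deg : ∀ v → t v ≤ deg (pathAdj n) v)
  (ℓ s : Fin n) (tℓ : t ℓ ≡ 2) (ℓ-min : ∀ i → t i ≡ 2 → toℕ ℓ ≤ toℕ i)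
  (ts : t s ≡ 2) (s-max : ∀ i → t i ≡ 2 → toℕ i ≤ toℕ s) (ℓ<s : toℕ ℓ < toℕ s)
  (S₀ : Subset n) (r₀ : ℕ) (S₀-infects : ∀ v → Inf (pathAdj n) t λw S₀ r₀ v ≡ true) where

  open Process (pathAdj n) t λw
  open OnPath t λw

  -- On the path t ≤ deg ≤ 2, so every node other than those of threshold 2 has threshold 1.
  light : ∀ v → t v ≢ 2 → t v ≤ 1
  light v t≢2 = ≤-pred (≤∧≢⇒< (≤-trans (t≤deg v) (path-deg≤2 v)) t≢2)

  light-left : ∀ v → toℕ v < toℕ ℓ → t v ≤ 1
  light-left v v<ℓ = light v λ t≡2 → <⇒≱ v<ℓ (ℓ-min v t≡2)

  light-right : ∀ v → toℕ s < toℕ v → t v ≤ 1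
  light-right v s<v = light v λ t≡2 → <⇒≱ s<v (s-max v t≡2)

  -- a node of threshold 2 walls off any interval it ends
  heavy : ∀ z → t z ≡ 2 → ∀ y → toℕ y ≡ toℕ z → 2 ≤ t y
  heavy z t≡2 y y≡z = ≤-reflexive (sym (trans (cong t (toℕ-injective y≡z)) t≡2))

  -- ℓ is not the first node, which has degree 1
  0<ℓ : 0 < toℕ ℓ
  0<ℓ = n≢0⇒n>0 λ ℓ≡0 → contradiction
    (≤-trans (≤-reflexive (sym tℓ)) (≤-trans (t≤deg ℓ) (path-deg-first ℓ ℓ≡0))) λ { (s≤s ()) }

  -- S₀ infects everything, so it has a seed in every walled interval.
  seed-in : ∀ {a b} → a < b → (∀ y → toℕ y ≡ a → 0 < a → 2 ≤ t y) → (∀ y → toℕ y ≡ b → suc b < n → 2 ≤ t y) →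
            ∀ x → Between a b x → ∃ λ y → y ∈ S₀ × Between a b y
  seed-in a<b left-wall right-wall x x∈ =
    interval-seed S₀ a<b t≥1 left-wall right-wall r₀ x x∈ (S₀-infects x)

  -- If ℓ is not a seed of S₀, some seed lies left of ℓ (the interval [0,ℓ] is walled by ℓ).
  seed-left : ℓ ∉ S₀ → ∃ λ y → y ∈ S₀ × toℕ y < toℕ ℓ
  seed-left ℓ∉S₀ with seed-in 0<ℓ (λ _ _ ()) (λ y y≡ℓ _ → heavy ℓ tℓ y y≡ℓ) ℓ (z≤n , ≤-refl)
  ... | y , y∈S₀ , _ , y≤ℓ = y , y∈S₀ , ≤∧≢⇒< y≤ℓ λ y≡ℓ → ℓ∉S₀ (subst (_∈ S₀) (toℕ-injective y≡ℓ) y∈S₀)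

  -- If s is not a seed of S₀, some seed lies right of s (the interval [s,n] is walled by s).
  seed-right : s ∉ S₀ → ∃ λ y → y ∈ S₀ × toℕ s < toℕ y
  seed-right s∉S₀ with seed-in (toℕ<n s) (λ y y≡s _ → heavy s ts y y≡s)
                         (λ y y≡n _ → contradiction (toℕ<n y) (<-irrefl y≡n)) s (≤-refl , <⇒≤ (toℕ<n s))
  ... | y , y∈S₀ , s≤y , _ = y , y∈S₀ , ≤∧≢⇒< s≤y λ s≡y → s∉S₀ (subst (_∈ S₀) (toℕ-injective (sym s≡y)) y∈S₀)

  -- Without a seed of S₀ in [ℓ,v] the nodes of (ℓ,v] have threshold 1:
  -- a node y there of threshold 2 would wall off the seedless interval [ℓ,y].
  light-after-ℓ : ∀ (v : Fin n) → ¬ (∃ λ p → p ∈ S₀ × Between (toℕ ℓ) (toℕ v) p) →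
                  ∀ y → toℕ ℓ < toℕ y → toℕ y ≤ toℕ v → t y ≤ 1
  light-after-ℓ v seedless y ℓ<y y≤v = light y λ ty≡2 →
    let p , p∈S₀ , ℓ≤p , p≤y = seed-in ℓ<y (λ z z≡ℓ _ → heavy ℓ tℓ z z≡ℓ) (λ z z≡y _ → heavy y ty≡2 z z≡y)
                                       y (<⇒≤ ℓ<y , ≤-refl)
    in seedless (p , p∈S₀ , ℓ≤p , ≤-trans p≤y y≤v)

  light-before-s : ∀ (v : Fin n) → ¬ (∃ λ q → q ∈ S₀ × Between (toℕ v) (toℕ s) q) →
                   ∀ y → toℕ v ≤ toℕ y → toℕ y < toℕ s → t y ≤ 1
  light-before-s v seedless y v≤y y<s = light y λ ty≡2 →
    let q , q∈S₀ , y≤q , q≤s = seed-in y<s (λ z z≡y _ → heavy y ty≡2 z z≡y) (λ z z≡s _ → heavy s ts z z≡s)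
                                       y (≤-refl , <⇒≤ y<s)
    in seedless (q , q∈S₀ , ≤-trans v≤y y≤q , q≤s)

  S₀-left S₀-mid S₀-right : Subset n
  S₀-left  = S₀ ∩ ⟦ (λ u → toℕ u <? toℕ ℓ) ⟧
  S₀-mid   = S₀ ∩ ⟦ between? (toℕ ℓ) (toℕ s) ⟧
  S₀-right = S₀ ∩ ⟦ (λ u → toℕ s <? toℕ u) ⟧

  ∈S₀-left⁻ : ∀ {x} → x ∈ S₀-left → x ∈ S₀ × toℕ x < toℕ ℓ
  ∈S₀-left⁻ x∈ = let x∈S₀ , x∈⟦⟧ = x∈p∩q⁻ S₀ _ x∈ in x∈S₀ , ∈⟦⟧⁻ (λ u → toℕ u <? toℕ ℓ) x∈⟦⟧

  ∈S₀-mid⁻ : ∀ {x} → x ∈ S₀-mid → x ∈ S₀ × Between (toℕ ℓ) (toℕ s) x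
  ∈S₀-mid⁻ x∈ = let x∈S₀ , x∈⟦⟧ = x∈p∩q⁻ S₀ _ x∈ in x∈S₀ , ∈⟦⟧⁻ (between? (toℕ ℓ) (toℕ s)) x∈⟦⟧

  ∈S₀-right⁻ : ∀ {x} → x ∈ S₀-right → x ∈ S₀ × toℕ s < toℕ x
  ∈S₀-right⁻ x∈ = let x∈S₀ , x∈⟦⟧ = x∈p∩q⁻ S₀ _ x∈ in x∈S₀ , ∈⟦⟧⁻ (λ u → toℕ s <? toℕ u) x∈⟦⟧

  ∈S₀-mid⁺ : ∀ {x} → x ∈ S₀ → Between (toℕ ℓ) (toℕ s) x → x ∈ S₀-mid
  ∈S₀-mid⁺ x∈S₀ x∈[ℓ,s] = x∈p∩q⁺ (x∈S₀ , ∈⟦⟧⁺ (between? (toℕ ℓ) (toℕ s)) x∈[ℓ,s])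

  -- The three parts are disjoint subsets of S₀.
  parts-size : ∣ S₀-mid ∣ + ∣ S₀-left ∣ + ∣ S₀-right ∣ ≤ ∣ S₀ ∣
  parts-size = begin
    ∣ S₀-mid ∣ + ∣ S₀-left ∣ + ∣ S₀-right ∣ ≡⟨ cong (_+ ∣ S₀-right ∣) (disjoint⇒∣p∣+∣q∣≡∣p∪q∣ S₀-mid S₀-left mid∩left) ⟩
    ∣ S₀-mid ∪ S₀-left ∣ + ∣ S₀-right ∣     ≡⟨ disjoint⇒∣p∣+∣q∣≡∣p∪q∣ (S₀-mid ∪ S₀-left) S₀-right mid∪left∩right ⟩
    ∣ (S₀-mid ∪ S₀-left) ∪ S₀-right ∣       ≤⟨ p⊆q⇒∣p∣≤∣q∣ parts⊆S₀ ⟩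
    ∣ S₀ ∣                                  ∎
    where
    open ≤-Reasoning
    mid∩left : ∀ {x} → x ∈ S₀-mid → x ∉ S₀-left
    mid∩left x∈mid x∈left = <⇒≱ (proj₂ (∈S₀-left⁻ x∈left)) (proj₁ (proj₂ (∈S₀-mid⁻ x∈mid)))
    mid∪left∩right : ∀ {x} → x ∈ S₀-mid ∪ S₀-left → x ∉ S₀-right
    mid∪left∩right x∈ x∈right with x∈p∪q⁻ S₀-mid S₀-left x∈
    ... | inj₁ x∈mid  = <⇒≱ (proj₂ (∈S₀-right⁻ x∈right)) (proj₂ (proj₂ (∈S₀-mid⁻ x∈mid)))
    ... | inj₂ x∈left = <-asym (<-trans (proj₂ (∈S₀-left⁻ x∈left)) ℓ<s) (proj₂ (∈S₀-right⁻ x∈right))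
    parts⊆S₀ : (S₀-mid ∪ S₀-left) ∪ S₀-right ⊆ S₀
    parts⊆S₀ x∈ with x∈p∪q⁻ (S₀-mid ∪ S₀-left) S₀-right x∈
    ... | inj₂ x∈right = proj₁ (∈S₀-right⁻ x∈right)
    ... | inj₁ x∈ml with x∈p∪q⁻ S₀-mid S₀-left x∈ml
    ...   | inj₁ x∈mid  = proj₁ (∈S₀-mid⁻ x∈mid)
    ...   | inj₂ x∈left = proj₁ (∈S₀-left⁻ x∈left)

  S′ : Subset n
  S′ = (S₀-mid ∪ ⁅ ℓ ⁆) ∪ ⁅ s ⁆

  ∈S′⁻ : ∀ {x} → x ∈ S′ → (x ∈ S₀ × Between (toℕ ℓ) (toℕ s) x) ⊎ (x ≡ ℓ ⊎ x ≡ s)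
  ∈S′⁻ x∈S′ with x∈p∪q⁻ _ _ x∈S′
  ... | inj₂ x∈⁅s⁆ = inj₂ (inj₂ (x∈⁅y⁆⇒x≡y s x∈⁅s⁆))
  ... | inj₁ x∈ with x∈p∪q⁻ _ _ x∈
  ...   | inj₂ x∈⁅ℓ⁆  = inj₂ (inj₁ (x∈⁅y⁆⇒x≡y ℓ x∈⁅ℓ⁆))
  ...   | inj₁ x∈mid = inj₁ (∈S₀-mid⁻ x∈mid)

  mid-seed∈S′ : ∀ {x} → x ∈ S₀ → Between (toℕ ℓ) (toℕ s) x → x ∈ S′
  mid-seed∈S′ x∈S₀ x∈[ℓ,s] = x∈p∪q⁺ (inj₁ (x∈p∪q⁺ (inj₁ (∈S₀-mid⁺ x∈S₀ x∈[ℓ,s]))))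

  ℓ∈S′ : ℓ ∈ S′
  ℓ∈S′ = x∈p∪q⁺ (inj₁ (x∈p∪q⁺ (inj₂ (x∈⁅x⁆ ℓ))))

  s∈S′ : s ∈ S′
  s∈S′ = x∈p∪q⁺ (inj₂ (x∈⁅x⁆ s))

  S′-left : ∀ i → toℕ i < toℕ ℓ → i ∉ S′
  S′-left i i<ℓ i∈S′ with ∈S′⁻ i∈S′
  ... | inj₁ (_ , ℓ≤i , _) = <⇒≱ i<ℓ ℓ≤i
  ... | inj₂ (inj₁ refl)   = <-irrefl refl i<ℓ
  ... | inj₂ (inj₂ refl)   = <-asym i<ℓ ℓ<s

  S′-right : ∀ i → toℕ s < toℕ i → i ∉ S′
  S′-right i s<i i∈S′ with ∈S′⁻ i∈S′
  ... | inj₁ (_ , _ , i≤s) = <⇒≱ s<i i≤s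
  ... | inj₂ (inj₁ refl)   = <-asym s<i ℓ<s
  ... | inj₂ (inj₂ refl)   = <-irrefl refl s<i

  ℓ-paid : ℓ ∈ S₀-mid ⊎ Nonempty S₀-left
  ℓ-paid with ℓ ∈? S₀
  ... | yes ℓ∈S₀ = inj₁ (∈S₀-mid⁺ ℓ∈S₀ (≤-refl , <⇒≤ ℓ<s))
  ... | no  ℓ∉S₀ = let y , y∈S₀ , y<ℓ = seed-left ℓ∉S₀ in
                   inj₂ (y , x∈p∩q⁺ (y∈S₀ , ∈⟦⟧⁺ (λ u → toℕ u <? toℕ ℓ) y<ℓ))

  s-paid : s ∈ S₀-mid ∪ ⁅ ℓ ⁆ ⊎ Nonempty S₀-right
  s-paid with s ∈? S₀
  ... | yes s∈S₀ = inj₁ (x∈p∪q⁺ (inj₁ (∈S₀-mid⁺ s∈S₀ (<⇒≤ ℓ<s , ≤-refl))))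
  ... | no  s∉S₀ = let y , y∈S₀ , s<y = seed-right s∉S₀ in
                   inj₂ (y , x∈p∩q⁺ (y∈S₀ , ∈⟦⟧⁺ (λ u → toℕ s <? toℕ u) s<y))

  S′-size : ∣ S′ ∣ ≤ ∣ S₀ ∣
  S′-size = begin
    ∣ (S₀-mid ∪ ⁅ ℓ ⁆) ∪ ⁅ s ⁆ ∣             ≤⟨ ∣p∪⁅x⁆∣≤∣p∣+∣q∣ s-paid ⟩
    ∣ S₀-mid ∪ ⁅ ℓ ⁆ ∣ + ∣ S₀-right ∣        ≤⟨ +-monoˡ-≤ ∣ S₀-right ∣ (∣p∪⁅x⁆∣≤∣p∣+∣q∣ ℓ-paid) ⟩
    ∣ S₀-mid ∣ + ∣ S₀-left ∣ + ∣ S₀-right ∣  ≤⟨ parts-size ⟩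
    ∣ S₀ ∣                                   ∎
    where open ≤-Reasoning

  Enclosed : Fin n → Set
  Enclosed v = (∃ λ p → p ∈ S₀ × Between (toℕ ℓ) (toℕ v) p) × (∃ λ q → q ∈ S₀ × Between (toℕ v) (toℕ s) q)

  -- On enclosed nodes S₀ and S′ have the same seeds (ℓ or s is enclosed only as a seed of S₀).
  enclosed-seeds : ∀ v → Enclosed v → (v ∈ S₀ → v ∈ S′) × (v ∈ S′ → v ∈ S₀)
  enclosed-seeds v ((p , p∈S₀ , ℓ≤p , p≤v) , (q , q∈S₀ , v≤q , q≤s)) =
    (λ v∈S₀ → mid-seed∈S′ v∈S₀ (≤-trans ℓ≤p p≤v , ≤-trans v≤q q≤s)) , from-S′
    where
    from-S′ : v ∈ S′ → v ∈ S₀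
    from-S′ v∈S′ with ∈S′⁻ v∈S′
    ... | inj₁ (v∈S₀ , _) = v∈S₀
    ... | inj₂ (inj₁ refl) = subst (_∈ S₀) (toℕ-injective (≤-antisym p≤v ℓ≤p)) p∈S₀
    ... | inj₂ (inj₂ refl) = subst (_∈ S₀) (toℕ-injective (≤-antisym q≤s v≤q)) q∈S₀

  -- The neighbours of an enclosed non-seed are enclosed, by the same two seeds.
  enclosed-closed : ∀ v u → Enclosed v → v ∉ S₀ → pathAdj n v u ≡ true → Enclosed u
  enclosed-closed v u ((p , p∈S₀ , ℓ≤p , p≤v) , (q , q∈S₀ , v≤q , q≤s)) v∉S₀ adj≡ with pathAdj⇒ adj≡
  ... | inj₁ u≡1+v = (p , p∈S₀ , ℓ≤p , ≤-trans p≤v (≤-trans (n≤1+n _) (≤-reflexive (sym u≡1+v))))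
                   , (q , q∈S₀ , subst (_≤ toℕ q) (sym u≡1+v) v<q , q≤s)
    where
    v<q : toℕ v < toℕ q
    v<q = ≤∧≢⇒< v≤q λ v≡q → v∉S₀ (subst (_∈ S₀) (toℕ-injective (sym v≡q)) q∈S₀)
  ... | inj₂ v≡1+u = (p , p∈S₀ , ℓ≤p , ≤-pred (subst (toℕ p <_) v≡1+u p<v))
                   , (q , q∈S₀ , ≤-trans (n≤1+n _) (≤-trans (≤-reflexive (sym v≡1+u)) v≤q) , q≤s)
    where
    p<v : toℕ p < toℕ v
    p<v = ≤∧≢⇒< p≤v λ p≡v → v∉S₀ (subst (_∈ S₀) (toℕ-injective p≡v) p∈S₀)

  -- A node of [ℓ,s] is infected by S′: from ℓ if no seed of S₀ precedes it in [ℓ,s],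
  -- from s if none follows it, and exactly as by S₀ if it is enclosed.
  S′-infects-middle : ∀ v → toℕ ℓ ≤ toℕ v → toℕ v ≤ toℕ s → ∃ λ r → infected S′ r v ≡ true
  S′-infects-middle v ℓ≤v v≤s with any? (λ p → (p ∈? S₀) ×-dec between? (toℕ ℓ) (toℕ v) p)
                                   | any? (λ q → (q ∈? S₀) ×-dec between? (toℕ v) (toℕ s) q)
  ... | no none-before | _ = toℕ v ∸ toℕ ℓ ,
    spread-right 1≤λ S′ ℓ ℓ∈S′ (toℕ v ∸ toℕ ℓ) v (sym (m+[n∸m]≡n ℓ≤v)) (light-after-ℓ v none-before)
  ... | yes _ | no none-after = toℕ s ∸ toℕ v ,
    spread-left 1≤λ S′ s s∈S′ (toℕ s ∸ toℕ v) v (m+[n∸m]≡n v≤s) (light-before-s v none-after)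
  ... | yes before | yes after =
    r₀ , trans (sym (locality S₀ S′ Enclosed enclosed-seeds enclosed-closed r₀ v (before , after))) (S₀-infects v)

  -- Every node is infected by S′: outside [ℓ,s] infection spreads from ℓ or s.
  S′-infects : ∀ v → ∃ λ r → infected S′ r v ≡ true
  S′-infects v with toℕ v <? toℕ ℓ | toℕ s <? toℕ v
  ... | yes v<ℓ | _ = toℕ ℓ ∸ toℕ v ,
    spread-left 1≤λ S′ ℓ ℓ∈S′ (toℕ ℓ ∸ toℕ v) v (m+[n∸m]≡n (<⇒≤ v<ℓ)) (λ y _ y<ℓ → light-left y y<ℓ)
  ... | no _ | yes s<v = toℕ v ∸ toℕ s ,
    spread-right 1≤λ S′ s s∈S′ (toℕ v ∸ toℕ s) v (sym (m+[n∸m]≡n (<⇒≤ s<v)))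
                 (λ y s<y _ → light-right y s<y)
  ... | no v≮ℓ | no v≯s = S′-infects-middle v (≮⇒≥ v≮ℓ) (≮⇒≥ v≯s)

distinct⇒< : ∀ {n} {i j : Fin n} {a b} → i ≢ j →
             a ≤ toℕ i → toℕ i ≤ b → a ≤ toℕ j → toℕ j ≤ b → a < b
distinct⇒< {a = a} {b} i≢j a≤i i≤b a≤j j≤b =
  ≰⇒> λ b≤a → i≢j (toℕ-injective (trans (squeeze a≤i i≤b b≤a) (sym (squeeze a≤j j≤b b≤a))))
  where
  squeeze : ∀ {x} → a ≤ x → x ≤ b → b ≤ a → x ≡ a
  squeeze a≤x x≤b b≤a = ≤-antisym (≤-trans x≤b b≤a) a≤x

-- The theorem: take a minimum-size target set S₀ (one exists since all of V is
-- a target set); its normal form S′ is a target set no larger than S₀, hence of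
-- minimum size, and it has the required shape.
lemma1 : (λw : ℕ) → 1 ≤ λw → (n : ℕ) → (t : Fin n → ℕ) →
    (∀ v → 1 ≤ t v) → (∀ v → t v ≤ deg (pathAdj n) v) →
    (∃ λ i → ∃ λ j → i ≢ j × t i ≡ 2 × t j ≡ 2) →
    (ℓ s : Fin n) →
    t ℓ ≡ 2 → (∀ i → t i ≡ 2 → toℕ ℓ ≤ toℕ i) →
    t s ≡ 2 → (∀ i → t i ≡ 2 → toℕ i ≤ toℕ s) →
    ∃ λ (S : Subset n) → IsMinTWCTarget (pathAdj n) t λw S ×
      (∀ i → toℕ i < toℕ ℓ → i ∉ S) × (∀ i → toℕ s < toℕ i → i ∉ S) ×
      ℓ ∈ S × s ∈ S
lemma1 λw 1≤λ n t t≥1 t≤deg (i , j , i≢j , ti , tj) ℓ s tℓ ℓ-min ts s-max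
  with Process.Settling.minimum-target (pathAdj n) t λw t≥1 n (⊤ , (0 , λ v → []=⇒lookup (∈⊤ {x = v})) , ∣p∣≤n ⊤)
... | S₀ , (r₀ , S₀-infects) , S₀-minimal =
  S′ , (target-if-all-infected S′ S′-infects , λ T T-target → ≤-trans S′-size (S₀-minimal T T-target)) ,
  S′-left , S′-right , ℓ∈S′ , s∈S′
  where
  open Process.Settling (pathAdj n) t λw t≥1 using (target-if-all-infected)
  ℓ<s : toℕ ℓ < toℕ s
  ℓ<s = distinct⇒< i≢j (ℓ-min i ti) (s-max i ti) (ℓ-min j tj) (s-max j tj)
  open NormalForm λw 1≤λ n t t≥1 t≤deg ℓ s tℓ ℓ-min ts s-max ℓ<s S₀ r₀ S₀-infects
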